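{- Let $j$ be an integer and $n$ a non-negative integer. Then \[ \sum_{k=0}^n\binom{n}{k}\frac{2^kF_{jk}}{L_j^k}B_{n-k}=\frac{n}{\sqrt5}\Big(\frac{\sqrt5F_j}{L_j}\Big)^{n-1}\quad\text{if } n \text{ is even}, \] \[ \sum_{k=0}^n\binom{n}{k}\frac{2^kL_{jk}}{L_j^k}B_{n-k}=n\Big(\frac{\sqrt5F_j}{L_j}\Big)^{n-1}\quad\text{if } n \text{ is odd}. \]
   Context: $\alpha=\frac{1+\sqrt5}{2}$, $\beta=\frac{1-\sqrt5}{2}$. For every integer $s$, $F_s=\frac{\alpha^s-\beta^s}{\sqrt5}$ and $L_s=\alpha^s+\beta^s$ (Fibonacci and Lucas numbers extended to all integers). The Bernoulli numbers $B_n$ are defined by $\sum_{n\ge0}B_n\frac{z^n}{n!}=\frac{z}{e^z-1}$. For $n=0$ the right-hand side of the first identity is interpreted as $0$. -}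

module Defs where

open import Data.Nat as ℕ using (ℕ; zero; suc)
open import Data.Nat.Combinatorics using (_C_)
open import Data.Integer as ℤ using (ℤ; +_; -[1+_])
open import Data.Rational as ℚ using (ℚ; 0ℚ; 1ℚ)
open import Data.Rational.Properties using () renaming (_≟_ to _≟ℚ_)
open import Data.List using (List; []; _∷_; _++_; zipWith; upTo; foldr; foldl; map)
open import Relation.Nullary using (yes; no)

-- Rationals: total inverse (0⁻¹ = 0) and the embedding of ℕ

invℚ : ℚ → ℚ
invℚ p with p ≟ℚ 0ℚ
... | yes _ = 0ℚ
... | no p≢0 = ℚ.1/_ p {{ℚ.≢-nonZero p≢0}}

ℕ→ℚ : ℕ → ℚ
ℕ→ℚ n = (+ n) ℚ./ 1

-- Bernoulli numbers, B₀ = 1 and  Σ_{k=0}^{m} C(m+1,k) B_k = 0  (m ≥ 1),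
-- which is the recurrence equivalent to  Σ B_n zⁿ/n! = z/(eᶻ-1)  (B₁ = -1/2).

sumℚ : List ℚ → ℚ
sumℚ = foldr ℚ._+_ 0ℚ

nextB : ℕ → List ℚ → ℚ
nextB m bs =
  ℚ.-_ (((+ 1) ℚ./ suc m) ℚ.* sumℚ (zipWith (λ k b → ℕ→ℚ (suc m C k) ℚ.* b) (upTo m) bs))

bernList : ℕ → List ℚ
bernList zero = 1ℚ ∷ []
bernList (suc n) = bernList n ++ (nextB (suc n) (bernList n) ∷ [])

B : ℕ → ℚ
B n = foldl (λ _ x → x) 0ℚ (bernList n)

-- The field ℚ(√5): a + b√5 represented as the pair (a , b)

record Q5 : Set where
  constructor _+√5·_
  field
    re : ℚ
    im : ℚ
open Q5 public

infixl 6 _⊕_ _⊖_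
infixl 7 _⊗_ _⊘_

_⊕_ : Q5 → Q5 → Q5
(a +√5· b) ⊕ (c +√5· d) = (a ℚ.+ c) +√5· (b ℚ.+ d)

⊝_ : Q5 → Q5
⊝ (a +√5· b) = ℚ.-_ a +√5· ℚ.-_ b

_⊖_ : Q5 → Q5 → Q5
x ⊖ y = x ⊕ (⊝ y)

_⊗_ : Q5 → Q5 → Q5
(a +√5· b) ⊗ (c +√5· d) =
  ((a ℚ.* c) ℚ.+ (ℕ→ℚ 5 ℚ.* (b ℚ.* d))) +√5· ((a ℚ.* d) ℚ.+ (b ℚ.* c))

-- total inverse: (a + b√5)⁻¹ = (a - b√5)/(a² - 5b²), and 0⁻¹ = 0
inv : Q5 → Q5
inv (a +√5· b) =
  let N = (a ℚ.* a) ℚ.- (ℕ→ℚ 5 ℚ.* (b ℚ.* b)) in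
  (a ℚ.* invℚ N) +√5· (ℚ.-_ b ℚ.* invℚ N)

_⊘_ : Q5 → Q5 → Q5
x ⊘ y = x ⊗ inv y

fromℚ : ℚ → Q5
fromℚ q = q +√5· 0ℚ

fromℕ : ℕ → Q5
fromℕ n = fromℚ (ℕ→ℚ n)

𝟘 𝟙 √5 : Q5
𝟘 = fromℚ 0ℚ
𝟙 = fromℚ 1ℚ
√5 = 0ℚ +√5· 1ℚ

_^ℕ_ : Q5 → ℕ → Q5
x ^ℕ zero = 𝟙
x ^ℕ suc n = x ⊗ (x ^ℕ n)

_^ℤ_ : Q5 → ℤ → Q5
x ^ℤ (+ n) = x ^ℕ n
x ^ℤ -[1+ n ] = inv (x ^ℕ suc n)

sumQ5 : List Q5 → Q5
sumQ5 = foldr _⊕_ 𝟘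

Σ[k≤_] : ℕ → (ℕ → Q5) → Q5
Σ[k≤ n ] f = sumQ5 (map f (upTo (suc n)))

α β : Q5
α = ((+ 1) ℚ./ 2) +√5· ((+ 1) ℚ./ 2)
β = ((+ 1) ℚ./ 2) +√5· ((ℤ.- (+ 1)) ℚ./ 2)

F : ℤ → Q5
F s = ((α ^ℤ s) ⊖ (β ^ℤ s)) ⊘ √5

L : ℤ → Q5
L s = (α ^ℤ s) ⊕ (β ^ℤ s)

lhsF : ℤ → ℕ → Q5
lhsF j n = Σ[k≤ n ] (λ k →
  fromℕ (n C k) ⊗ ((fromℕ (2 ℕ.^ k) ⊗ F (j ℤ.* (+ k))) ⊘ (L j ^ℕ k)) ⊗ fromℚ (B (n ℕ.∸ k)))

lhsL : ℤ → ℕ → Q5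
lhsL j n = Σ[k≤ n ] (λ k →
  fromℕ (n C k) ⊗ ((fromℕ (2 ℕ.^ k) ⊗ L (j ℤ.* (+ k))) ⊘ (L j ^ℕ k)) ⊗ fromℚ (B (n ℕ.∸ k)))

-- n/√5 · (√5 F_j / L_j)^{n-1}, interpreted as 0 for n = 0
rhsEven : ℤ → ℕ → Q5
rhsEven j zero = 𝟘
rhsEven j (suc m) = (fromℕ (suc m) ⊘ √5) ⊗ (((√5 ⊗ F j) ⊘ L j) ^ℕ m)

-- n · (√5 F_j / L_j)^{n-1}   (n odd, so n ≥ 1)
rhsOdd : ℤ → ℕ → Q5
rhsOdd j zero = 𝟘
rhsOdd j (suc m) = fromℕ (suc m) ⊗ (((√5 ⊗ F j) ⊘ L j) ^ℕ m)

{-# OPTIONS --safe #-}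
module Submission where

-- Put a = 2αʲ/Lⱼ, b = 2βʲ/Lⱼ and c = √5Fⱼ/Lⱼ. Since Lⱼ = αʲ + βʲ and √5Fⱼ = αʲ − βʲ,
-- a = 1 + c and b = 1 − c, and αʲᵏ = (αʲ)ᵏ turns the left-hand sides into
-- (Bₙ(1 + c) − Bₙ(1 − c))/√5 and Bₙ(1 + c) + Bₙ(1 − c), where Bₙ(x) = Σₖ C(n,k) xᵏ Bₙ₋ₖ.
-- The reflection Bₙ(1 − x) = (−1)ⁿ Bₙ(x) and the difference equation Bₙ(1 + x) − Bₙ(x) = n xⁿ⁻¹
-- turn either expression into n cⁿ⁻¹ for the relevant parity of n.
-- Both facts are identities of exponential generating functions: B(z)(eᶻ − 1) = z,
-- B(−z) = eᶻ B(z) and eᶻ B(z) = B(z) + z, the latter two proved by cancelling the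
-- factor eᶻ − 1. The only division needed besides 1/√5 is by Lⱼ, which is ± a positive Lucas number.

open import Defs
open import Data.Nat using (ℕ)
open import Data.Nat.Divisibility using (_∣_)
open import Data.Integer using (ℤ)
open import Data.Product using (_×_)
open import Relation.Nullary using (¬_)
open import Relation.Binary.PropositionalEquality using (_≡_)

open import Algebra.Bundles using (CommutativeRing)
open import Algebra.Structures using (IsCommutativeRing)
import Algebra.Properties.CommutativeSemigroup as CommutativeSemigroupProperties
import Algebra.Properties.Group as GroupProperties
import Algebra.Solver.Ring.AlmostCommutativeRing as AlmostCommutativeRing
import Algebra.Solver.Ring.Simple as SimpleRingSolver
open import Data.Empty using (⊥-elim)
open import Data.Integer as ℤ using (+_; -[1+_])
import Data.Integer.Properties as ℤP
open import Data.List using ([]; _∷_; _++_; _∷ʳ_; applyUpTo; upTo; zipWith; map)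
import Data.List.Properties as ListP
open import Data.Nat as ℕ using (zero; suc)
open import Data.Nat.Combinatorics using (_C_; nCk+nC[k+1]≡[n+1]C[k+1]; k>n⇒nCk≡0; nCk≡nC[n∸k]; nC1≡n)
import Data.Nat.Coprimality as Coprimality
open import Data.Nat.Divisibility using (divides)
import Data.Nat.Properties as ℕP
open import Data.Product using (∃; _,_; proj₁; proj₂)
open import Data.Rational as ℚ using (ℚ; 0ℚ; 1ℚ)
import Data.Rational.Properties as ℚP
open import Data.Rational.Solver using (module +-*-Solver)
open import Data.Sum using (_⊎_; inj₁; inj₂)
open import Function using (_∘_)
open import Relation.Binary.PropositionalEquality
  using (refl; sym; trans; cong; cong₂; subst; isEquivalence; _≗_; module ≡-Reasoning)
open import Relation.Nullary using (Dec; yes; no)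

-- ℚ(√5) as a commutative ring

five : ℚ
five = ℕ→ℚ 5

-- The solvers for ℚ and for ℚ(√5) export the same names, so the former is only opened locally.
module _ where
  open +-*-Solver

  ⊕-assoc : ∀ x y z → (x ⊕ y) ⊕ z ≡ x ⊕ (y ⊕ z)
  ⊕-assoc (a +√5· b) (c +√5· d) (e +√5· f) = cong₂ _+√5·_ (ℚP.+-assoc a c e) (ℚP.+-assoc b d f)

  ⊕-comm : ∀ x y → x ⊕ y ≡ y ⊕ x
  ⊕-comm (a +√5· b) (c +√5· d) = cong₂ _+√5·_ (ℚP.+-comm a c) (ℚP.+-comm b d)

  ⊕-identityˡ : ∀ x → 𝟘 ⊕ x ≡ x
  ⊕-identityˡ (a +√5· b) = cong₂ _+√5·_ (ℚP.+-identityˡ a) (ℚP.+-identityˡ b)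

  ⊕-identityʳ : ∀ x → x ⊕ 𝟘 ≡ x
  ⊕-identityʳ (a +√5· b) = cong₂ _+√5·_ (ℚP.+-identityʳ a) (ℚP.+-identityʳ b)

  ⊝-inverseˡ : ∀ x → (⊝ x) ⊕ x ≡ 𝟘
  ⊝-inverseˡ (a +√5· b) = cong₂ _+√5·_ (ℚP.+-inverseˡ a) (ℚP.+-inverseˡ b)

  ⊝-inverseʳ : ∀ x → x ⊕ (⊝ x) ≡ 𝟘
  ⊝-inverseʳ (a +√5· b) = cong₂ _+√5·_ (ℚP.+-inverseʳ a) (ℚP.+-inverseʳ b)

  ⊗-assoc : ∀ x y z → (x ⊗ y) ⊗ z ≡ x ⊗ (y ⊗ z)
  ⊗-assoc (a +√5· b) (c +√5· d) (e +√5· f) = cong₂ _+√5·_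
    (solve 7 (λ a b c d e f k → (a :* c :+ k :* (b :* d)) :* e :+ k :* ((a :* d :+ b :* c) :* f)
                             := a :* (c :* e :+ k :* (d :* f)) :+ k :* (b :* (c :* f :+ d :* e)))
           refl a b c d e f five)
    (solve 7 (λ a b c d e f k → (a :* c :+ k :* (b :* d)) :* f :+ (a :* d :+ b :* c) :* e
                             := a :* (c :* f :+ d :* e) :+ b :* (c :* e :+ k :* (d :* f)))
           refl a b c d e f five)

  ⊗-comm : ∀ x y → x ⊗ y ≡ y ⊗ x
  ⊗-comm (a +√5· b) (c +√5· d) = cong₂ _+√5·_
    (solve 5 (λ a b c d k → a :* c :+ k :* (b :* d) := c :* a :+ k :* (d :* b)) refl a b c d five)
    (solve 4 (λ a b c d → a :* d :+ b :* c := c :* b :+ d :* a) refl a b c d)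

  ⊗-identityˡ : ∀ x → 𝟙 ⊗ x ≡ x
  ⊗-identityˡ (a +√5· b) = cong₂ _+√5·_
    (solve 3 (λ a b k → con 1ℚ :* a :+ k :* (con 0ℚ :* b) := a) refl a b five)
    (solve 2 (λ a b → con 1ℚ :* b :+ con 0ℚ :* a := b) refl a b)

  ⊗-identityʳ : ∀ x → x ⊗ 𝟙 ≡ x
  ⊗-identityʳ x = trans (⊗-comm x 𝟙) (⊗-identityˡ x)

  ⊗-distribˡ-⊕ : ∀ x y z → x ⊗ (y ⊕ z) ≡ x ⊗ y ⊕ x ⊗ z
  ⊗-distribˡ-⊕ (a +√5· b) (c +√5· d) (e +√5· f) = cong₂ _+√5·_
    (solve 7 (λ a b c d e f k → a :* (c :+ e) :+ k :* (b :* (d :+ f))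
                             := (a :* c :+ k :* (b :* d)) :+ (a :* e :+ k :* (b :* f)))
           refl a b c d e f five)
    (solve 6 (λ a b c d e f → a :* (d :+ f) :+ b :* (c :+ e) := (a :* d :+ b :* c) :+ (a :* f :+ b :* e))
           refl a b c d e f)

  ⊗-distribʳ-⊕ : ∀ x y z → (y ⊕ z) ⊗ x ≡ y ⊗ x ⊕ z ⊗ x
  ⊗-distribʳ-⊕ x y z =
    trans (⊗-comm (y ⊕ z) x) (trans (⊗-distribˡ-⊕ x y z) (cong₂ _⊕_ (⊗-comm x y) (⊗-comm x z)))

Q5-isCommutativeRing : IsCommutativeRing _≡_ _⊕_ _⊗_ ⊝_ 𝟘 𝟙
Q5-isCommutativeRing = record
  { isRing = record
    { +-isAbelianGroup = record
      { isGroup = record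
        { isMonoid = record
          { isSemigroup = record
            { isMagma = record { isEquivalence = isEquivalence ; ∙-cong = cong₂ _⊕_ }
            ; assoc = ⊕-assoc }
          ; identity = ⊕-identityˡ , ⊕-identityʳ }
        ; inverse = ⊝-inverseˡ , ⊝-inverseʳ
        ; ⁻¹-cong = cong ⊝_ }
      ; comm = ⊕-comm }
    ; *-cong = cong₂ _⊗_
    ; *-assoc = ⊗-assoc
    ; *-identity = ⊗-identityˡ , ⊗-identityʳ
    ; distrib = ⊗-distribˡ-⊕ , ⊗-distribʳ-⊕ }
  ; *-comm = ⊗-comm }

Q5-commutativeRing : CommutativeRing _ _
Q5-commutativeRing = record { isCommutativeRing = Q5-isCommutativeRing }

open CommutativeSemigroupProperties (CommutativeRing.+-commutativeSemigroup Q5-commutativeRing)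
  using (interchange)
open GroupProperties (CommutativeRing.+-group Q5-commutativeRing)
  using () renaming (∙-cancelˡ to ⊕-cancelˡ)
open CommutativeRing Q5-commutativeRing using () renaming (zeroˡ to ⊗-zeroˡ)

_≟_ : (x y : Q5) → Dec (x ≡ y)
(a +√5· b) ≟ (c +√5· d) with a ℚP.≟ c | b ℚP.≟ d
... | yes refl | yes refl = yes refl
... | no a≢c   | _        = no λ { refl → a≢c refl }
... | _        | no b≢d   = no λ { refl → b≢d refl }

module _ where
  open +-*-Solver

  ℕ→ℚ≡mkℚ : ∀ n → ℕ→ℚ n ≡ ℚ.mkℚ (+ n) 0 (Coprimality.sym (Coprimality.1-coprimeTo n))
  ℕ→ℚ≡mkℚ n = ℚP.normalize-coprime (Coprimality.sym (Coprimality.1-coprimeTo n))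

  ℕ→ℚ-suc : ∀ n → ℕ→ℚ (suc n) ≡ 1ℚ ℚ.+ ℕ→ℚ n
  ℕ→ℚ-suc n = trans (ℚP./-cong (cong (ℤ._+_ (+ 1)) (sym (ℤP.*-identityʳ (+ n)))) refl)
                    (cong (1ℚ ℚ.+_) (sym (ℕ→ℚ≡mkℚ n)))

  ℕ→ℚ-+ : ∀ m n → ℕ→ℚ (m ℕ.+ n) ≡ ℕ→ℚ m ℚ.+ ℕ→ℚ n
  ℕ→ℚ-+ zero    n = sym (ℚP.+-identityˡ (ℕ→ℚ n))
  ℕ→ℚ-+ (suc m) n = begin
    ℕ→ℚ (suc m ℕ.+ n)               ≡⟨ ℕ→ℚ-suc (m ℕ.+ n) ⟩
    1ℚ ℚ.+ ℕ→ℚ (m ℕ.+ n)            ≡⟨ cong (1ℚ ℚ.+_) (ℕ→ℚ-+ m n) ⟩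
    1ℚ ℚ.+ (ℕ→ℚ m ℚ.+ ℕ→ℚ n)        ≡⟨ ℚP.+-assoc 1ℚ (ℕ→ℚ m) (ℕ→ℚ n) ⟨
    (1ℚ ℚ.+ ℕ→ℚ m) ℚ.+ ℕ→ℚ n        ≡⟨ cong (ℚ._+ ℕ→ℚ n) (ℕ→ℚ-suc m) ⟨
    ℕ→ℚ (suc m) ℚ.+ ℕ→ℚ n           ∎
    where open ≡-Reasoning

  ℕ→ℚ-* : ∀ m n → ℕ→ℚ (m ℕ.* n) ≡ ℕ→ℚ m ℚ.* ℕ→ℚ n
  ℕ→ℚ-* zero    n = sym (ℚP.*-zeroˡ (ℕ→ℚ n))
  ℕ→ℚ-* (suc m) n = begin
      ℕ→ℚ (n ℕ.+ m ℕ.* n)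
    ≡⟨ trans (ℕ→ℚ-+ n (m ℕ.* n)) (cong (ℕ→ℚ n ℚ.+_) (ℕ→ℚ-* m n)) ⟩
      ℕ→ℚ n ℚ.+ ℕ→ℚ m ℚ.* ℕ→ℚ n
    ≡⟨ solve 2 (λ x y → y :+ x :* y := (con 1ℚ :+ x) :* y) refl (ℕ→ℚ m) (ℕ→ℚ n) ⟩
      (1ℚ ℚ.+ ℕ→ℚ m) ℚ.* ℕ→ℚ n
    ≡⟨ cong (ℚ._* ℕ→ℚ n) (ℕ→ℚ-suc m) ⟨
      ℕ→ℚ (suc m) ℚ.* ℕ→ℚ n
    ∎
    where open ≡-Reasoning

  ℕ→ℚ-suc-inverse : ∀ m → ℕ→ℚ (suc m) ℚ.* ((+ 1) ℚ./ suc m) ≡ 1ℚ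
  ℕ→ℚ-suc-inverse m = trans (cong₂ ℚ._*_ (ℕ→ℚ≡mkℚ (suc m)) 1/q≡) (ℚP.*-inverseʳ q)
    where
    q : ℚ
    q = ℚ.mkℚ (+ suc m) 0 (Coprimality.sym (Coprimality.1-coprimeTo (suc m)))
    1/q≡ : (+ 1) ℚ./ suc m ≡ ℚ.1/ q
    1/q≡ = ℚP.normalize-coprime (Coprimality.1-coprimeTo (suc m))

  fromℚ-* : ∀ a b → fromℚ (a ℚ.* b) ≡ fromℚ a ⊗ fromℚ b
  fromℚ-* a b = cong₂ _+√5·_
    (solve 3 (λ a b k → a :* b := a :* b :+ k :* (con 0ℚ :* con 0ℚ)) refl a b five)
    (solve 2 (λ a b → con 0ℚ := a :* con 0ℚ :+ con 0ℚ :* b) refl a b)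

  invℚ-unique : ∀ p q → p ℚ.* q ≡ 1ℚ → invℚ p ≡ q
  invℚ-unique p q pq≡1 with p ℚP.≟ 0ℚ
  ... | yes refl = 0≢1 (trans (sym (ℚP.*-zeroˡ q)) pq≡1)
    where
    0≢1 : 0ℚ ≡ 1ℚ → 0ℚ ≡ q
    0≢1 ()
  ... | no p≢0 = begin
    p⁻¹                  ≡⟨ ℚP.*-identityʳ p⁻¹ ⟨
    p⁻¹ ℚ.* 1ℚ           ≡⟨ cong (p⁻¹ ℚ.*_) pq≡1 ⟨
    p⁻¹ ℚ.* (p ℚ.* q)    ≡⟨ ℚP.*-assoc p⁻¹ p q ⟨
    (p⁻¹ ℚ.* p) ℚ.* q    ≡⟨ cong (ℚ._* q) (ℚP.*-inverseˡ p {{ℚ.≢-nonZero p≢0}}) ⟩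
    1ℚ ℚ.* q             ≡⟨ ℚP.*-identityˡ q ⟩
    q                    ∎
    where
    open ≡-Reasoning
    p⁻¹ : ℚ
    p⁻¹ = ℚ.1/_ p {{ℚ.≢-nonZero p≢0}}

  inv-unique : ∀ x y → x ⊗ y ≡ 𝟙 → inv x ≡ y
  inv-unique (a +√5· b) (c +√5· d) xy≡1 = cong₂ _+√5·_ re≡ im≡
    where
    re-xy : a ℚ.* c ℚ.+ five ℚ.* (b ℚ.* d) ≡ 1ℚ
    re-xy = cong re xy≡1
    im-xy : a ℚ.* d ℚ.+ b ℚ.* c ≡ 0ℚ
    im-xy = cong im xy≡1
    normˣ normʸ : ℚ
    normˣ = (a ℚ.* a) ℚ.- (five ℚ.* (b ℚ.* b))
    normʸ = (c ℚ.* c) ℚ.- (five ℚ.* (d ℚ.* d))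
    norm-multiplicative : normˣ ℚ.* normʸ ≡ 1ℚ
    norm-multiplicative = trans
      (solve 5 (λ a b c d k → ((a :* a) :- (k :* (b :* b))) :* ((c :* c) :- (k :* (d :* d)))
                           := (a :* c :+ k :* (b :* d)) :* (a :* c :+ k :* (b :* d))
                              :- k :* ((a :* d :+ b :* c) :* (a :* d :+ b :* c)))
             refl a b c d five)
      (trans (cong₂ (λ r i → r ℚ.* r ℚ.- five ℚ.* (i ℚ.* i)) re-xy im-xy)
             (solve 1 (λ k → con 1ℚ :* con 1ℚ :- k :* (con 0ℚ :* con 0ℚ) := con 1ℚ) refl five))
    invℚ-normˣ : invℚ normˣ ≡ normʸ
    invℚ-normˣ = invℚ-unique normˣ normʸ norm-multiplicative
    re≡ : a ℚ.* invℚ normˣ ≡ c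
    re≡ = trans (cong (a ℚ.*_) invℚ-normˣ)
      (trans (solve 5 (λ a b c d k → a :* ((c :* c) :- (k :* (d :* d)))
                                  := c :* (a :* c :+ k :* (b :* d)) :- k :* (d :* (a :* d :+ b :* c)))
                    refl a b c d five)
      (trans (cong₂ (λ r i → c ℚ.* r ℚ.- five ℚ.* (d ℚ.* i)) re-xy im-xy)
             (solve 3 (λ c d k → c :* con 1ℚ :- k :* (d :* con 0ℚ) := c) refl c d five)))
    im≡ : ℚ.- b ℚ.* invℚ normˣ ≡ d
    im≡ = trans (cong (ℚ.- b ℚ.*_) invℚ-normˣ)
      (trans (solve 5 (λ a b c d k → (:- b) :* ((c :* c) :- (k :* (d :* d)))
                                  := d :* (a :* c :+ k :* (b :* d)) :- c :* (a :* d :+ b :* c))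
                    refl a b c d five)
      (trans (cong₂ (λ r i → d ℚ.* r ℚ.- c ℚ.* i) re-xy im-xy)
             (solve 2 (λ c d → d :* con 1ℚ :- c :* con 0ℚ := d) refl c d)))

open SimpleRingSolver (AlmostCommutativeRing.fromCommutativeRing Q5-commutativeRing) _≟_
  using (solve; _:=_; _:+_; _:*_; _:-_; :-_; con)

fromℕ-+ : ∀ m n → fromℕ (m ℕ.+ n) ≡ fromℕ m ⊕ fromℕ n
fromℕ-+ m n = cong fromℚ (ℕ→ℚ-+ m n)

fromℕ-* : ∀ m n → fromℕ (m ℕ.* n) ≡ fromℕ m ⊗ fromℕ n
fromℕ-* m n = trans (cong fromℚ (ℕ→ℚ-* m n)) (fromℚ-* (ℕ→ℚ m) (ℕ→ℚ n))

Invertible : Q5 → Set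
Invertible x = ∃ λ y → x ⊗ y ≡ 𝟙

⊗-cancelˡ : ∀ x → Invertible x → ∀ a b → x ⊗ a ≡ x ⊗ b → a ≡ b
⊗-cancelˡ x (y , xy≡1) a b xa≡xb = begin
  a                ≡⟨ undo a ⟨
  y ⊗ (x ⊗ a)      ≡⟨ cong (y ⊗_) xa≡xb ⟩
  y ⊗ (x ⊗ b)      ≡⟨ undo b ⟩
  b                ∎
  where
  open ≡-Reasoning
  undo : ∀ z → y ⊗ (x ⊗ z) ≡ z
  undo z = trans (sym (⊗-assoc y x z)) (trans (cong (_⊗ z) (trans (⊗-comm y x) xy≡1)) (⊗-identityˡ z))

fromℕ-suc-invertible : ∀ m → Invertible (fromℕ (suc m))
fromℕ-suc-invertible m =
  fromℚ ((+ 1) ℚ./ suc m) ,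
  trans (sym (fromℚ-* (ℕ→ℚ (suc m)) ((+ 1) ℚ./ suc m))) (cong fromℚ (ℕ→ℚ-suc-inverse m))

⊗-invertible : ∀ x y → Invertible x → Invertible y → Invertible (x ⊗ y)
⊗-invertible x y (x′ , xx′≡1) (y′ , yy′≡1) = x′ ⊗ y′ , (begin
  (x ⊗ y) ⊗ (x′ ⊗ y′)     ≡⟨ solve 4 (λ x y x′ y′ → (x :* y) :* (x′ :* y′) := (x :* x′) :* (y :* y′))
                                     refl x y x′ y′ ⟩
  (x ⊗ x′) ⊗ (y ⊗ y′)     ≡⟨ cong₂ _⊗_ xx′≡1 yy′≡1 ⟩
  𝟙 ⊗ 𝟙                   ≡⟨ ⊗-identityˡ 𝟙 ⟩
  𝟙                       ∎)
  where open ≡-Reasoning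

^ℕ-distribʳ-⊗ : ∀ x y k → (x ⊗ y) ^ℕ k ≡ x ^ℕ k ⊗ y ^ℕ k
^ℕ-distribʳ-⊗ x y zero    = sym (⊗-identityˡ 𝟙)
^ℕ-distribʳ-⊗ x y (suc k) = trans (cong ((x ⊗ y) ⊗_) (^ℕ-distribʳ-⊗ x y k))
  (solve 4 (λ x y p q → (x :* y) :* (p :* q) := (x :* p) :* (y :* q)) refl x y (x ^ℕ k) (y ^ℕ k))

^ℕ-distribˡ-+-⊗ : ∀ x m k → x ^ℕ (m ℕ.+ k) ≡ x ^ℕ m ⊗ x ^ℕ k
^ℕ-distribˡ-+-⊗ x zero    k = sym (⊗-identityˡ (x ^ℕ k))
^ℕ-distribˡ-+-⊗ x (suc m) k =
  trans (cong (x ⊗_) (^ℕ-distribˡ-+-⊗ x m k)) (sym (⊗-assoc x (x ^ℕ m) (x ^ℕ k)))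

^ℕ-*-assoc : ∀ x m k → (x ^ℕ m) ^ℕ k ≡ x ^ℕ (m ℕ.* k)
^ℕ-*-assoc x m zero    = cong (x ^ℕ_) (sym (ℕP.*-zeroʳ m))
^ℕ-*-assoc x m (suc k) = begin
  x ^ℕ m ⊗ (x ^ℕ m) ^ℕ k     ≡⟨ cong (x ^ℕ m ⊗_) (^ℕ-*-assoc x m k) ⟩
  x ^ℕ m ⊗ x ^ℕ (m ℕ.* k)    ≡⟨ ^ℕ-distribˡ-+-⊗ x m (m ℕ.* k) ⟨
  x ^ℕ (m ℕ.+ m ℕ.* k)       ≡⟨ cong (x ^ℕ_) (ℕP.*-suc m k) ⟨
  x ^ℕ (m ℕ.* suc k)         ∎
  where open ≡-Reasoning

^ℕ-inverse : ∀ x y → x ⊗ y ≡ 𝟙 → ∀ k → x ^ℕ k ⊗ y ^ℕ k ≡ 𝟙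
^ℕ-inverse x y xy≡1 k = trans (sym (^ℕ-distribʳ-⊗ x y k)) (trans (cong (_^ℕ k) xy≡1) (𝟙^ℕ k))
  where
  𝟙^ℕ : ∀ k → 𝟙 ^ℕ k ≡ 𝟙
  𝟙^ℕ zero    = refl
  𝟙^ℕ (suc k) = trans (cong (𝟙 ⊗_) (𝟙^ℕ k)) (⊗-identityˡ 𝟙)

^ℤ-*-assoc : ∀ x y → x ⊗ y ≡ 𝟙 → ∀ j k → (x ^ℤ j) ^ℕ k ≡ x ^ℤ (j ℤ.* + k)
^ℤ-*-assoc x y xy≡1 (+ m)    k       = trans (^ℕ-*-assoc x m k) (cong (x ^ℤ_) (ℤP.pos-* m k))
^ℤ-*-assoc x y xy≡1 -[1+ m ] zero    = cong (x ^ℤ_) (sym (ℤP.*-zeroʳ -[1+ m ]))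
^ℤ-*-assoc x y xy≡1 -[1+ m ] (suc k) = begin
    inv (x ^ℕ suc m) ^ℕ suc k
  ≡⟨ cong (_^ℕ suc k) (inv-unique (x ^ℕ suc m) (y ^ℕ suc m) (^ℕ-inverse x y xy≡1 (suc m))) ⟩
    (y ^ℕ suc m) ^ℕ suc k
  ≡⟨ ^ℕ-*-assoc y (suc m) (suc k) ⟩
    y ^ℕ (suc m ℕ.* suc k)
  ≡⟨ inv-unique (x ^ℕ (suc m ℕ.* suc k)) (y ^ℕ (suc m ℕ.* suc k))
                (^ℕ-inverse x y xy≡1 (suc m ℕ.* suc k)) ⟨
    inv (x ^ℕ (suc m ℕ.* suc k))
  ∎
  where open ≡-Reasoning

-𝟙 : Q5
-𝟙 = ⊝ 𝟙

sgn : ℕ → Q5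
sgn k = -𝟙 ^ℕ k

sgn-square : ∀ n → sgn n ⊗ sgn n ≡ 𝟙
sgn-square = ^ℕ-inverse -𝟙 -𝟙 refl

⊝-^ℕ : ∀ x k → (⊝ x) ^ℕ k ≡ sgn k ⊗ x ^ℕ k
⊝-^ℕ x zero    = sym (⊗-identityˡ 𝟙)
⊝-^ℕ x (suc k) = trans (cong ((⊝ x) ⊗_) (⊝-^ℕ x k))
  (solve 3 (λ x s p → (:- x) :* (s :* p) := (con -𝟙 :* s) :* (x :* p)) refl x (sgn k) (x ^ℕ k))

sgn-even : ∀ p → sgn (p ℕ.* 2) ≡ 𝟙
sgn-even zero    = refl
sgn-even (suc p) = trans (cong (λ s → -𝟙 ⊗ (-𝟙 ⊗ s)) (sgn-even p))
                         (solve 0 (con -𝟙 :* (con -𝟙 :* con 𝟙) := con 𝟙) refl)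

even⊎odd : ∀ n → ∃ λ p → n ≡ p ℕ.* 2 ⊎ n ≡ suc (p ℕ.* 2)
even⊎odd zero = 0 , inj₁ refl
even⊎odd (suc n) with even⊎odd n
... | p , inj₁ n≡2p   = p , inj₂ (cong suc n≡2p)
... | p , inj₂ n≡2p+1 = suc p , inj₁ (cong suc n≡2p+1)

sgn-2∣ : ∀ {n} → 2 ∣ n → sgn n ≡ 𝟙
sgn-2∣ (divides p refl) = sgn-even p

sgn-2∤ : ∀ n → ¬ (2 ∣ n) → sgn n ≡ -𝟙
sgn-2∤ n 2∤n with even⊎odd n
... | p , inj₁ n≡2p = ⊥-elim (2∤n (divides p n≡2p))
... | p , inj₂ refl = trans (cong (-𝟙 ⊗_) (sgn-even p)) (⊗-identityʳ -𝟙)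

-- Binomial convolution

sumTo : ℕ → (ℕ → Q5) → Q5
sumTo zero    f = 𝟘
sumTo (suc n) f = f 0 ⊕ sumTo n (f ∘ suc)

sumQ5-map-applyUpTo : ∀ (f : ℕ → Q5) g n → sumQ5 (map f (applyUpTo g n)) ≡ sumTo n (f ∘ g)
sumQ5-map-applyUpTo f g zero    = refl
sumQ5-map-applyUpTo f g (suc n) = cong (f (g 0) ⊕_) (sumQ5-map-applyUpTo f (g ∘ suc) n)

Σ[k≤]≡sumTo : ∀ n f → Σ[k≤ n ] f ≡ sumTo (suc n) f
Σ[k≤]≡sumTo n f = sumQ5-map-applyUpTo f (λ k → k) (suc n)

sumTo-cong : ∀ n {f g} → (∀ k → k ℕ.< n → f k ≡ g k) → sumTo n f ≡ sumTo n g
sumTo-cong zero    f≡g = refl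
sumTo-cong (suc n) f≡g =
  cong₂ _⊕_ (f≡g 0 (ℕ.s≤s ℕ.z≤n)) (sumTo-cong n (λ k k<n → f≡g (suc k) (ℕ.s≤s k<n)))

sumTo-⊕ : ∀ n f g → sumTo n (λ k → f k ⊕ g k) ≡ sumTo n f ⊕ sumTo n g
sumTo-⊕ zero    f g = sym (⊕-identityˡ 𝟘)
sumTo-⊕ (suc n) f g = trans (cong (f 0 ⊕ g 0 ⊕_) (sumTo-⊕ n (f ∘ suc) (g ∘ suc)))
                            (interchange (f 0) (g 0) (sumTo n (f ∘ suc)) (sumTo n (g ∘ suc)))

sumTo-suc : ∀ n f → sumTo (suc n) f ≡ sumTo n f ⊕ f n
sumTo-suc zero    f = trans (⊕-identityʳ (f 0)) (sym (⊕-identityˡ (f 0)))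
sumTo-suc (suc n) f =
  trans (cong (f 0 ⊕_) (sumTo-suc n (f ∘ suc))) (sym (⊕-assoc (f 0) (sumTo n (f ∘ suc)) (f (suc n))))

Seq : Set
Seq = ℕ → Q5

Δ : Seq → Seq
Δ f n = f (suc n)

infixl 6 _+s_
infixr 8 _·s_
infixl 7 _⋆_

_+s_ : Seq → Seq → Seq
(f +s g) n = f n ⊕ g n

_·s_ : Q5 → Seq → Seq
(c ·s f) n = c ⊗ f n

-- The product of exponential generating functions, defined through the
-- Leibniz rule (f g)′ = f′ g + f g′ rather than the binomial sum of ⋆-binomial.
_⋆_ : Seq → Seq → Seq
(f ⋆ g) zero    = f 0 ⊗ g 0
(f ⋆ g) (suc n) = (Δ f ⋆ g) n ⊕ (f ⋆ Δ g) n

⋆-cong : ∀ {f f′ g g′} → f ≗ f′ → g ≗ g′ → f ⋆ g ≗ f′ ⋆ g′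
⋆-cong f≗f′ g≗g′ zero    = cong₂ _⊗_ (f≗f′ 0) (g≗g′ 0)
⋆-cong f≗f′ g≗g′ (suc n) =
  cong₂ _⊕_ (⋆-cong (f≗f′ ∘ suc) g≗g′ n) (⋆-cong f≗f′ (g≗g′ ∘ suc) n)

⋆-congˡ : ∀ {f f′} g → f ≗ f′ → f ⋆ g ≗ f′ ⋆ g
⋆-congˡ g f≗f′ = ⋆-cong f≗f′ (λ _ → refl)

⋆-congʳ : ∀ f {g g′} → g ≗ g′ → f ⋆ g ≗ f ⋆ g′
⋆-congʳ f = ⋆-cong (λ _ → refl)

⋆-comm : ∀ f g → f ⋆ g ≗ g ⋆ f
⋆-comm f g zero    = ⊗-comm (f 0) (g 0)
⋆-comm f g (suc n) =
  trans (cong₂ _⊕_ (⋆-comm (Δ f) g n) (⋆-comm f (Δ g) n)) (⊕-comm ((g ⋆ Δ f) n) ((Δ g ⋆ f) n))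

⋆-distribʳ-+s : ∀ g f f′ → (f +s f′) ⋆ g ≗ f ⋆ g +s f′ ⋆ g
⋆-distribʳ-+s g f f′ zero    = ⊗-distribʳ-⊕ (g 0) (f 0) (f′ 0)
⋆-distribʳ-+s g f f′ (suc n) =
  trans (cong₂ _⊕_ (⋆-distribʳ-+s g (Δ f) (Δ f′) n) (⋆-distribʳ-+s (Δ g) f f′ n))
        (interchange ((Δ f ⋆ g) n) ((Δ f′ ⋆ g) n) ((f ⋆ Δ g) n) ((f′ ⋆ Δ g) n))

⋆-distribˡ-+s : ∀ f g g′ → f ⋆ (g +s g′) ≗ f ⋆ g +s f ⋆ g′
⋆-distribˡ-+s f g g′ n = trans (⋆-comm f (g +s g′) n)
  (trans (⋆-distribʳ-+s f g g′ n) (cong₂ _⊕_ (⋆-comm g f n) (⋆-comm g′ f n)))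

⋆-scaleˡ : ∀ c f g → (c ·s f) ⋆ g ≗ c ·s (f ⋆ g)
⋆-scaleˡ c f g zero    = ⊗-assoc c (f 0) (g 0)
⋆-scaleˡ c f g (suc n) = trans (cong₂ _⊕_ (⋆-scaleˡ c (Δ f) g n) (⋆-scaleˡ c f (Δ g) n))
                               (sym (⊗-distribˡ-⊕ c ((Δ f ⋆ g) n) ((f ⋆ Δ g) n)))

⋆-scaleʳ : ∀ c f g → f ⋆ (c ·s g) ≗ c ·s (f ⋆ g)
⋆-scaleʳ c f g n =
  trans (⋆-comm f (c ·s g) n) (trans (⋆-scaleˡ c g f n) (cong (c ⊗_) (⋆-comm g f n)))

⋆-assoc : ∀ f g h → (f ⋆ g) ⋆ h ≗ f ⋆ (g ⋆ h)
⋆-assoc f g h zero    = ⊗-assoc (f 0) (g 0) (h 0)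
⋆-assoc f g h (suc n) = begin
    ((Δ f ⋆ g +s f ⋆ Δ g) ⋆ h) n ⊕ ((f ⋆ g) ⋆ Δ h) n
  ≡⟨ cong (_⊕ ((f ⋆ g) ⋆ Δ h) n) (⋆-distribʳ-+s h (Δ f ⋆ g) (f ⋆ Δ g) n) ⟩
    (((Δ f ⋆ g) ⋆ h) n ⊕ ((f ⋆ Δ g) ⋆ h) n) ⊕ ((f ⋆ g) ⋆ Δ h) n
  ≡⟨ cong₂ _⊕_ (cong₂ _⊕_ (⋆-assoc (Δ f) g h n) (⋆-assoc f (Δ g) h n)) (⋆-assoc f g (Δ h) n) ⟩
    ((Δ f ⋆ (g ⋆ h)) n ⊕ (f ⋆ (Δ g ⋆ h)) n) ⊕ (f ⋆ (g ⋆ Δ h)) n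
  ≡⟨ ⊕-assoc ((Δ f ⋆ (g ⋆ h)) n) ((f ⋆ (Δ g ⋆ h)) n) ((f ⋆ (g ⋆ Δ h)) n) ⟩
    (Δ f ⋆ (g ⋆ h)) n ⊕ ((f ⋆ (Δ g ⋆ h)) n ⊕ (f ⋆ (g ⋆ Δ h)) n)
  ≡⟨ cong ((Δ f ⋆ (g ⋆ h)) n ⊕_) (⋆-distribˡ-+s f (Δ g ⋆ h) (g ⋆ Δ h) n) ⟨
    (Δ f ⋆ (g ⋆ h)) n ⊕ (f ⋆ (Δ g ⋆ h +s g ⋆ Δ h)) n
  ∎
  where open ≡-Reasoning

δ : Seq
δ zero    = 𝟙
δ (suc _) = 𝟘

⋆-identityˡ : ∀ f → δ ⋆ f ≗ f
⋆-identityˡ f zero    = ⊗-identityˡ (f 0)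
⋆-identityˡ f (suc n) = begin
  (Δ δ ⋆ f) n ⊕ (δ ⋆ Δ f) n      ≡⟨ cong₂ _⊕_ Δδ⋆f≡𝟘 (⋆-identityˡ (Δ f) n) ⟩
  𝟘 ⊕ f (suc n)                   ≡⟨ ⊕-identityˡ (f (suc n)) ⟩
  f (suc n)                       ∎
  where
  open ≡-Reasoning
  Δδ⋆f≡𝟘 : (Δ δ ⋆ f) n ≡ 𝟘
  Δδ⋆f≡𝟘 = trans (⋆-congˡ f (λ _ → sym (⊗-zeroˡ 𝟘)) n)
                 (trans (⋆-scaleˡ 𝟘 (Δ δ) f n) (⊗-zeroˡ ((Δ δ ⋆ f) n)))

binomialTerm : ℕ → Seq → Seq → Seq
binomialTerm n f g k = fromℕ (n C k) ⊗ f k ⊗ g (n ℕ.∸ k)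

n∸k≡1+n∸[1+k] : ∀ {n k} → k ℕ.< n → n ℕ.∸ k ≡ suc (n ℕ.∸ suc k)
n∸k≡1+n∸[1+k] {n} {k} k<n = ℕP.+-∸-assoc 1 {n} {suc k} k<n

⋆-binomial : ∀ n f g → (f ⋆ g) n ≡ sumTo (suc n) (binomialTerm n f g)
⋆-binomial zero    f g =
  sym (trans (⊕-identityʳ (𝟙 ⊗ f 0 ⊗ g 0)) (cong (_⊗ g 0) (⊗-identityˡ (f 0))))
⋆-binomial (suc n) f g = sym (begin
    T (suc n) f g 0 ⊕ sumTo (suc n) (T (suc n) f g ∘ suc)
  ≡⟨ cong (T (suc n) f g 0 ⊕_)
          (trans (sumTo-cong (suc n) (λ k _ → pascal k)) (sumTo-⊕ (suc n) (T n (Δ f) g) h)) ⟩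
    T (suc n) f g 0 ⊕ (sumTo (suc n) (T n (Δ f) g) ⊕ sumTo (suc n) h)
  ≡⟨ cong (λ s → T (suc n) f g 0 ⊕ (sumTo (suc n) (T n (Δ f) g) ⊕ s)) sumTo-h ⟩
    T (suc n) f g 0 ⊕ (sumTo (suc n) (T n (Δ f) g) ⊕ sumTo n h)
  ≡⟨ solve 3 (λ a b c → a :+ (b :+ c) := b :+ (a :+ c))
           refl (T (suc n) f g 0) (sumTo (suc n) (T n (Δ f) g)) (sumTo n h) ⟩
    sumTo (suc n) (T n (Δ f) g) ⊕ (T n f (Δ g) 0 ⊕ sumTo n h)
  ≡⟨ cong (λ s → sumTo (suc n) (T n (Δ f) g) ⊕ (T n f (Δ g) 0 ⊕ s)) (sumTo-cong n h≡) ⟩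
    sumTo (suc n) (T n (Δ f) g) ⊕ sumTo (suc n) (T n f (Δ g))
  ≡⟨ cong₂ _⊕_ (⋆-binomial n (Δ f) g) (⋆-binomial n f (Δ g)) ⟨
    (Δ f ⋆ g) n ⊕ (f ⋆ Δ g) n
  ∎)
  where
  open ≡-Reasoning
  T : ℕ → Seq → Seq → Seq
  T = binomialTerm
  h : Seq
  h k = fromℕ (n C suc k) ⊗ f (suc k) ⊗ g (n ℕ.∸ k)
  pascal : ∀ k → T (suc n) f g (suc k) ≡ T n (Δ f) g k ⊕ h k
  pascal k = begin
      fromℕ (suc n C suc k) ⊗ f (suc k) ⊗ g (n ℕ.∸ k)
    ≡⟨ cong (λ c → fromℕ c ⊗ f (suc k) ⊗ g (n ℕ.∸ k)) (nCk+nC[k+1]≡[n+1]C[k+1] n k) ⟨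
      fromℕ (n C k ℕ.+ n C suc k) ⊗ f (suc k) ⊗ g (n ℕ.∸ k)
    ≡⟨ cong (λ c → c ⊗ f (suc k) ⊗ g (n ℕ.∸ k)) (fromℕ-+ (n C k) (n C suc k)) ⟩
      (fromℕ (n C k) ⊕ fromℕ (n C suc k)) ⊗ f (suc k) ⊗ g (n ℕ.∸ k)
    ≡⟨ solve 4 (λ a b c d → (a :+ b) :* c :* d := a :* c :* d :+ b :* c :* d)
               refl (fromℕ (n C k)) (fromℕ (n C suc k)) (f (suc k)) (g (n ℕ.∸ k)) ⟩
      T n (Δ f) g k ⊕ h k
    ∎
  sumTo-h : sumTo (suc n) h ≡ sumTo n h
  sumTo-h = begin
      sumTo (suc n) h
    ≡⟨ sumTo-suc n h ⟩
      sumTo n h ⊕ h n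
    ≡⟨ cong (λ c → sumTo n h ⊕ fromℕ c ⊗ f (suc n) ⊗ g (n ℕ.∸ n)) (k>n⇒nCk≡0 (ℕP.n<1+n n)) ⟩
      sumTo n h ⊕ 𝟘 ⊗ f (suc n) ⊗ g (n ℕ.∸ n)
    ≡⟨ solve 3 (λ s a b → s :+ con 𝟘 :* a :* b := s) refl (sumTo n h) (f (suc n)) (g (n ℕ.∸ n)) ⟩
      sumTo n h
    ∎
  h≡ : ∀ k → k ℕ.< n → h k ≡ T n f (Δ g) (suc k)
  h≡ k k<n = cong (λ m → fromℕ (n C suc k) ⊗ f (suc k) ⊗ g m) (n∸k≡1+n∸[1+k] k<n)

⋆≡Σ : ∀ n f g → (f ⋆ g) n ≡ Σ[k≤ n ] (binomialTerm n f g)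
⋆≡Σ n f g = trans (⋆-binomial n f g) (sym (Σ[k≤]≡sumTo n (binomialTerm n f g)))

-- As exponential generating functions: expSeq is eᶻ, expm1Seq is eᶻ − 1, zSeq is z,
-- powSeq y is e^{yz} and alternate f is f(−z).
expSeq : Seq
expSeq _ = 𝟙

expm1Seq : Seq
expm1Seq zero    = 𝟘
expm1Seq (suc _) = 𝟙

zSeq : Seq
zSeq (suc zero) = 𝟙
zSeq _          = 𝟘

powSeq : Q5 → Seq
powSeq y k = y ^ℕ k

alternate : Seq → Seq
alternate f n = sgn n ⊗ f n

[1+m]C[m]≡1+m : ∀ m → suc m C m ≡ suc m
[1+m]C[m]≡1+m m = begin
  suc m C m                ≡⟨ nCk≡nC[n∸k] (ℕP.n≤1+n m) ⟩
  suc m C (suc m ℕ.∸ m)    ≡⟨ cong (suc m C_) (ℕP.m+n∸n≡m 1 m) ⟩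
  suc m C 1                ≡⟨ nC1≡n (suc m) ⟩
  suc m                    ∎
  where open ≡-Reasoning

⋆-expm1Seq : ∀ m x → (x ⋆ expm1Seq) (suc m) ≡ sumTo (suc m) (λ k → fromℕ (suc m C k) ⊗ x k)
⋆-expm1Seq m x = begin
    (x ⋆ expm1Seq) (suc m)
  ≡⟨ trans (⋆-binomial (suc m) x expm1Seq) (sumTo-suc (suc m) (T (suc m) x expm1Seq)) ⟩
    sumTo (suc m) (T (suc m) x expm1Seq) ⊕ T (suc m) x expm1Seq (suc m)
  ≡⟨ cong₂ _⊕_ (sumTo-cong (suc m) earlier-terms) last-term ⟩
    sumTo (suc m) (λ k → fromℕ (suc m C k) ⊗ x k) ⊕ 𝟘
  ≡⟨ ⊕-identityʳ (sumTo (suc m) (λ k → fromℕ (suc m C k) ⊗ x k)) ⟩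
    sumTo (suc m) (λ k → fromℕ (suc m C k) ⊗ x k)
  ∎
  where
  open ≡-Reasoning
  T : ℕ → Seq → Seq → Seq
  T = binomialTerm
  earlier-terms : ∀ k → k ℕ.< suc m → T (suc m) x expm1Seq k ≡ fromℕ (suc m C k) ⊗ x k
  earlier-terms k k≤m =
    trans (cong (λ i → fromℕ (suc m C k) ⊗ x k ⊗ expm1Seq i) (n∸k≡1+n∸[1+k] k≤m))
          (⊗-identityʳ (fromℕ (suc m C k) ⊗ x k))
  last-term : T (suc m) x expm1Seq (suc m) ≡ 𝟘
  last-term = trans (cong (λ i → fromℕ (suc m C suc m) ⊗ x (suc m) ⊗ expm1Seq i) (ℕP.n∸n≡0 m))
                    (solve 2 (λ a b → a :* b :* con 𝟘 := con 𝟘) refl (fromℕ (suc m C suc m)) (x (suc m)))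

-- The coefficients of x ⋆ expm1Seq form a triangular system in x with diagonal 1, 2, 3, …
⋆-expm1Seq-injective : ∀ {x y} → x ⋆ expm1Seq ≗ y ⋆ expm1Seq → x ≗ y
⋆-expm1Seq-injective {x} {y} x⋆≗y⋆ n = agree-below (suc n) n (ℕP.n<1+n n)
  where
  weighted : Seq → ℕ → Seq
  weighted f m k = fromℕ (suc m C k) ⊗ f k
  agree-below : ∀ m k → k ℕ.< m → x k ≡ y k
  agree-below (suc m) k k<1+m with ℕP.m<1+n⇒m<n∨m≡n k<1+m
  ... | inj₁ k<m  = agree-below m k k<m
  ... | inj₂ refl = ⊗-cancelˡ (fromℕ (suc m)) (fromℕ-suc-invertible m) (x m) (y m)
    (subst (λ c → fromℕ c ⊗ x m ≡ fromℕ c ⊗ y m) ([1+m]C[m]≡1+m m) top-terms)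
    where
    open ≡-Reasoning
    top-terms : weighted x m m ≡ weighted y m m
    top-terms = ⊕-cancelˡ (sumTo m (weighted x m)) (weighted x m m) (weighted y m m) (begin
      sumTo m (weighted x m) ⊕ weighted x m m     ≡⟨ sumTo-suc m (weighted x m) ⟨
      sumTo (suc m) (weighted x m)                ≡⟨ ⋆-expm1Seq m x ⟨
      (x ⋆ expm1Seq) (suc m)                      ≡⟨ x⋆≗y⋆ (suc m) ⟩
      (y ⋆ expm1Seq) (suc m)                      ≡⟨ ⋆-expm1Seq m y ⟩
      sumTo (suc m) (weighted y m)                ≡⟨ sumTo-suc m (weighted y m) ⟩
      sumTo m (weighted y m) ⊕ weighted y m m     ≡⟨ cong (_⊕ weighted y m m) (sumTo-cong m lower-terms) ⟨
      sumTo m (weighted x m) ⊕ weighted y m m     ∎)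
      where
      lower-terms : ∀ k → k ℕ.< m → weighted x m k ≡ weighted y m k
      lower-terms k k<m = cong (fromℕ (suc m C k) ⊗_) (agree-below m k k<m)

Δ-alternate : ∀ f → Δ (alternate f) ≗ -𝟙 ·s alternate (Δ f)
Δ-alternate f k = ⊗-assoc -𝟙 (sgn k) (f (suc k))

alternate-⋆ : ∀ f g → alternate f ⋆ alternate g ≗ alternate (f ⋆ g)
alternate-⋆ f g zero    =
  solve 2 (λ a b → (con 𝟙 :* a) :* (con 𝟙 :* b) := con 𝟙 :* (a :* b)) refl (f 0) (g 0)
alternate-⋆ f g (suc n) = begin
    (Δ (alternate f) ⋆ alternate g) n ⊕ (alternate f ⋆ Δ (alternate g)) n
  ≡⟨ cong₂ _⊕_ (trans (⋆-congˡ (alternate g) (Δ-alternate f) n)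
                      (⋆-scaleˡ -𝟙 (alternate (Δ f)) (alternate g) n))
               (trans (⋆-congʳ (alternate f) (Δ-alternate g) n)
                      (⋆-scaleʳ -𝟙 (alternate f) (alternate (Δ g)) n)) ⟩
    -𝟙 ⊗ (alternate (Δ f) ⋆ alternate g) n ⊕ -𝟙 ⊗ (alternate f ⋆ alternate (Δ g)) n
  ≡⟨ cong₂ (λ a b → -𝟙 ⊗ a ⊕ -𝟙 ⊗ b) (alternate-⋆ (Δ f) g n) (alternate-⋆ f (Δ g) n) ⟩
    -𝟙 ⊗ (sgn n ⊗ (Δ f ⋆ g) n) ⊕ -𝟙 ⊗ (sgn n ⊗ (f ⋆ Δ g) n)
  ≡⟨ solve 3 (λ s a b → con -𝟙 :* (s :* a) :+ con -𝟙 :* (s :* b) := (con -𝟙 :* s) :* (a :+ b))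
           refl (sgn n) ((Δ f ⋆ g) n) ((f ⋆ Δ g) n) ⟩
    sgn (suc n) ⊗ (f ⋆ g) (suc n)
  ∎
  where open ≡-Reasoning

alternate-expSeq⋆expSeq : alternate expSeq ⋆ expSeq ≗ δ
alternate-expSeq⋆expSeq zero    = solve 0 (con 𝟙 :* con 𝟙 :* con 𝟙 := con 𝟙) refl
alternate-expSeq⋆expSeq (suc n) =
  trans (cong (_⊕ (alternate expSeq ⋆ expSeq) n)
              (trans (⋆-congˡ expSeq (Δ-alternate expSeq) n) (⋆-scaleˡ -𝟙 (alternate expSeq) expSeq n)))
        (solve 1 (λ t → con -𝟙 :* t :+ t := con 𝟘) refl ((alternate expSeq ⋆ expSeq) n))

powSeq⋆expSeq : ∀ y → powSeq y ⋆ expSeq ≗ powSeq (𝟙 ⊕ y)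
powSeq⋆expSeq y zero    = ⊗-identityˡ 𝟙
powSeq⋆expSeq y (suc n) = begin
    (y ·s powSeq y ⋆ expSeq) n ⊕ (powSeq y ⋆ expSeq) n
  ≡⟨ cong (_⊕ (powSeq y ⋆ expSeq) n) (⋆-scaleˡ y (powSeq y) expSeq n) ⟩
    y ⊗ (powSeq y ⋆ expSeq) n ⊕ (powSeq y ⋆ expSeq) n
  ≡⟨ cong (λ t → y ⊗ t ⊕ t) (powSeq⋆expSeq y n) ⟩
    y ⊗ (𝟙 ⊕ y) ^ℕ n ⊕ (𝟙 ⊕ y) ^ℕ n
  ≡⟨ solve 2 (λ y p → y :* p :+ p := (con 𝟙 :+ y) :* p) refl y ((𝟙 ⊕ y) ^ℕ n) ⟩
    (𝟙 ⊕ y) ^ℕ suc n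
  ∎
  where open ≡-Reasoning

zSeq⋆-zero : ∀ f → (zSeq ⋆ f) 0 ≡ 𝟘
zSeq⋆-zero f = ⊗-zeroˡ (f 0)

zSeq⋆-suc : ∀ f m → (zSeq ⋆ f) (suc m) ≡ fromℕ (suc m) ⊗ f m
zSeq⋆-suc f m = begin
    (Δ zSeq ⋆ f) m ⊕ (zSeq ⋆ Δ f) m
  ≡⟨ cong (_⊕ (zSeq ⋆ Δ f) m) (trans (⋆-congˡ f Δ-zSeq m) (⋆-identityˡ f m)) ⟩
    f m ⊕ (zSeq ⋆ Δ f) m
  ≡⟨ shifted m ⟩
    fromℕ (suc m) ⊗ f m
  ∎
  where
  open ≡-Reasoning
  Δ-zSeq : Δ zSeq ≗ δ
  Δ-zSeq zero    = refl
  Δ-zSeq (suc k) = refl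
  shifted : ∀ m → f m ⊕ (zSeq ⋆ Δ f) m ≡ fromℕ (suc m) ⊗ f m
  shifted zero    = trans (cong (f 0 ⊕_) (zSeq⋆-zero (Δ f)))
                          (solve 1 (λ a → a :+ con 𝟘 := con 𝟙 :* a) refl (f 0))
  shifted (suc m) = begin
      f (suc m) ⊕ (zSeq ⋆ Δ f) (suc m)
    ≡⟨ cong (f (suc m) ⊕_) (zSeq⋆-suc (Δ f) m) ⟩
      f (suc m) ⊕ fromℕ (suc m) ⊗ f (suc m)
    ≡⟨ solve 2 (λ a c → a :+ c :* a := (con 𝟙 :+ c) :* a) refl (f (suc m)) (fromℕ (suc m)) ⟩
      (𝟙 ⊕ fromℕ (suc m)) ⊗ f (suc m)
    ≡⟨ cong (_⊗ f (suc m)) (fromℕ-+ 1 (suc m)) ⟨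
      fromℕ (suc (suc m)) ⊗ f (suc m)
    ∎

expm1Seq-reflection : expm1Seq ≗ -𝟙 ·s (alternate expm1Seq ⋆ expSeq)
expm1Seq-reflection n = sym (begin
    -𝟙 ⊗ (alternate expm1Seq ⋆ expSeq) n
  ≡⟨ cong (-𝟙 ⊗_) (⋆-congˡ expSeq alternate-expm1Seq n) ⟩
    -𝟙 ⊗ ((alternate expSeq +s -𝟙 ·s δ) ⋆ expSeq) n
  ≡⟨ cong (-𝟙 ⊗_) (⋆-distribʳ-+s expSeq (alternate expSeq) (-𝟙 ·s δ) n) ⟩
    -𝟙 ⊗ ((alternate expSeq ⋆ expSeq) n ⊕ (-𝟙 ·s δ ⋆ expSeq) n)
  ≡⟨ cong (λ t → -𝟙 ⊗ ((alternate expSeq ⋆ expSeq) n ⊕ t))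
          (trans (⋆-scaleˡ -𝟙 δ expSeq n) (cong (-𝟙 ⊗_) (⋆-identityˡ expSeq n))) ⟩
    -𝟙 ⊗ ((alternate expSeq ⋆ expSeq) n ⊕ -𝟙 ⊗ 𝟙)
  ≡⟨ cong (λ t → -𝟙 ⊗ (t ⊕ -𝟙 ⊗ 𝟙)) (alternate-expSeq⋆expSeq n) ⟩
    -𝟙 ⊗ (δ n ⊕ -𝟙 ⊗ 𝟙)
  ≡⟨ from-δ n ⟩
    expm1Seq n
  ∎)
  where
  open ≡-Reasoning
  alternate-expm1Seq : alternate expm1Seq ≗ alternate expSeq +s -𝟙 ·s δ
  alternate-expm1Seq zero    = solve 0 (con 𝟙 :* con 𝟘 := con 𝟙 :* con 𝟙 :+ con -𝟙 :* con 𝟙) refl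
  alternate-expm1Seq (suc k) =
    solve 1 (λ s → s :* con 𝟙 := s :* con 𝟙 :+ con -𝟙 :* con 𝟘) refl (sgn (suc k))
  from-δ : ∀ n → -𝟙 ⊗ (δ n ⊕ -𝟙 ⊗ 𝟙) ≡ expm1Seq n
  from-δ zero    = solve 0 (con -𝟙 :* (con 𝟙 :+ con -𝟙 :* con 𝟙) := con 𝟘) refl
  from-δ (suc n) = solve 0 (con -𝟙 :* (con 𝟘 :+ con -𝟙 :* con 𝟙) := con 𝟙) refl

-- Bernoulli numbers and polynomials

bernoulliSeq : Seq
bernoulliSeq k = fromℚ (B k)

B-suc : ∀ n → B (suc n) ≡ nextB (suc n) (bernList n)
B-suc n = ListP.foldl-++ (λ _ b → b) 0ℚ (bernList n) (nextB (suc n) (bernList n) ∷ [])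

bernList≡applyUpTo : ∀ n → bernList n ≡ applyUpTo B (suc n)
bernList≡applyUpTo zero    = refl
bernList≡applyUpTo (suc n) = begin
    bernList n ++ (nextB (suc n) (bernList n) ∷ [])
  ≡⟨ cong₂ (λ bs b → bs ++ (b ∷ [])) (bernList≡applyUpTo n) (sym (B-suc n)) ⟩
    applyUpTo B (suc n) ∷ʳ B (suc n)
  ≡⟨ ListP.applyUpTo-∷ʳ B (suc n) ⟩
    applyUpTo B (suc (suc n))
  ∎
  where open ≡-Reasoning

fromℚ-sumℚ-zipWith : ∀ m (h : ℕ → ℚ → ℚ) g b →
  fromℚ (sumℚ (zipWith h (applyUpTo g m) (applyUpTo b m))) ≡ sumTo m (λ k → fromℚ (h (g k) (b k)))
fromℚ-sumℚ-zipWith zero    h g b = refl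
fromℚ-sumℚ-zipWith (suc m) h g b =
  cong (fromℚ (h (g 0) (b 0)) ⊕_) (fromℚ-sumℚ-zipWith m h (g ∘ suc) (b ∘ suc))

bernoulli-recurrence : ∀ n → sumTo (suc (suc n)) (λ k → fromℕ (suc (suc n) C k) ⊗ bernoulliSeq k) ≡ 𝟘
bernoulli-recurrence n = begin
    sumTo (suc m) weighted
  ≡⟨ sumTo-suc m weighted ⟩
    sumTo m weighted ⊕ fromℕ (suc m C m) ⊗ bernoulliSeq m
  ≡⟨ cong₂ _⊕_ (sym fromℚ-s) (cong (λ c → fromℕ c ⊗ bernoulliSeq m) ([1+m]C[m]≡1+m m)) ⟩
    fromℚ s ⊕ fromℕ (suc m) ⊗ bernoulliSeq m
  ≡⟨ cong (λ b → fromℚ s ⊕ fromℕ (suc m) ⊗ fromℚ b) (B-suc n) ⟩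
    fromℚ s ⊕ fromℕ (suc m) ⊗ (⊝ fromℚ (r ℚ.* s))
  ≡⟨ cong (λ t → fromℚ s ⊕ fromℕ (suc m) ⊗ (⊝ t)) (fromℚ-* r s) ⟩
    fromℚ s ⊕ fromℕ (suc m) ⊗ (⊝ (fromℚ r ⊗ fromℚ s))
  ≡⟨ solve 3 (λ s c r → s :+ c :* (:- (r :* s)) := s :- (c :* r) :* s)
           refl (fromℚ s) (fromℕ (suc m)) (fromℚ r) ⟩
    fromℚ s ⊖ (fromℕ (suc m) ⊗ fromℚ r) ⊗ fromℚ s
  ≡⟨ cong (λ t → fromℚ s ⊖ t ⊗ fromℚ s) (proj₂ (fromℕ-suc-invertible m)) ⟩
    fromℚ s ⊖ 𝟙 ⊗ fromℚ s
  ≡⟨ solve 1 (λ s → s :- con 𝟙 :* s := con 𝟘) refl (fromℚ s) ⟩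
    𝟘
  ∎
  where
  open ≡-Reasoning
  m : ℕ
  m = suc n
  r s : ℚ
  r = (+ 1) ℚ./ suc m
  weighted : Seq
  weighted k = fromℕ (suc m C k) ⊗ bernoulliSeq k
  s = sumℚ (zipWith (λ k b → ℕ→ℚ (suc m C k) ℚ.* b) (upTo m) (bernList n))
  fromℚ-s : fromℚ s ≡ sumTo m weighted
  fromℚ-s = begin
    fromℚ s
      ≡⟨ cong (λ bs → fromℚ (sumℚ (zipWith (λ k b → ℕ→ℚ (suc m C k) ℚ.* b) (upTo m) bs)))
              (bernList≡applyUpTo n) ⟩
    fromℚ (sumℚ (zipWith (λ k b → ℕ→ℚ (suc m C k) ℚ.* b) (upTo m) (applyUpTo B m)))
      ≡⟨ fromℚ-sumℚ-zipWith m (λ k b → ℕ→ℚ (suc m C k) ℚ.* b) (λ k → k) B ⟩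
    sumTo m (λ k → fromℚ (ℕ→ℚ (suc m C k) ℚ.* B k))
      ≡⟨ sumTo-cong m (λ k _ → fromℚ-* (ℕ→ℚ (suc m C k)) (B k)) ⟩
    sumTo m weighted
      ∎

bernoulli⋆expm1 : bernoulliSeq ⋆ expm1Seq ≗ zSeq
bernoulli⋆expm1 zero          = solve 1 (λ b → b :* con 𝟘 := con 𝟘) refl (bernoulliSeq 0)
bernoulli⋆expm1 (suc zero)    = ⋆-expm1Seq 0 bernoulliSeq
bernoulli⋆expm1 (suc (suc n)) = trans (⋆-expm1Seq (suc n) bernoulliSeq) (bernoulli-recurrence n)

expSeq⋆bernoulli⋆expm1 : (expSeq ⋆ bernoulliSeq) ⋆ expm1Seq ≗ zSeq ⋆ expSeq
expSeq⋆bernoulli⋆expm1 n = begin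
  ((expSeq ⋆ bernoulliSeq) ⋆ expm1Seq) n    ≡⟨ ⋆-assoc expSeq bernoulliSeq expm1Seq n ⟩
  (expSeq ⋆ (bernoulliSeq ⋆ expm1Seq)) n    ≡⟨ ⋆-congʳ expSeq bernoulli⋆expm1 n ⟩
  (expSeq ⋆ zSeq) n                         ≡⟨ ⋆-comm expSeq zSeq n ⟩
  (zSeq ⋆ expSeq) n                         ∎
  where open ≡-Reasoning

alternate-bernoulli : alternate bernoulliSeq ≗ expSeq ⋆ bernoulliSeq
alternate-bernoulli = ⋆-expm1Seq-injective λ n → begin
    (alternate bernoulliSeq ⋆ expm1Seq) n
  ≡⟨ trans (⋆-congʳ (alternate bernoulliSeq) expm1Seq-reflection n)
           (⋆-scaleʳ -𝟙 (alternate bernoulliSeq) (alternate expm1Seq ⋆ expSeq) n) ⟩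
    -𝟙 ⊗ (alternate bernoulliSeq ⋆ (alternate expm1Seq ⋆ expSeq)) n
  ≡⟨ cong (-𝟙 ⊗_) (⋆-assoc (alternate bernoulliSeq) (alternate expm1Seq) expSeq n) ⟨
    -𝟙 ⊗ ((alternate bernoulliSeq ⋆ alternate expm1Seq) ⋆ expSeq) n
  ≡⟨ cong (-𝟙 ⊗_) (trans (⋆-congˡ expSeq alternate-z n) (⋆-scaleˡ -𝟙 zSeq expSeq n)) ⟩
    -𝟙 ⊗ (-𝟙 ⊗ (zSeq ⋆ expSeq) n)
  ≡⟨ solve 1 (λ t → con -𝟙 :* (con -𝟙 :* t) := t) refl ((zSeq ⋆ expSeq) n) ⟩
    (zSeq ⋆ expSeq) n
  ≡⟨ expSeq⋆bernoulli⋆expm1 n ⟨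
    ((expSeq ⋆ bernoulliSeq) ⋆ expm1Seq) n
  ∎
  where
  open ≡-Reasoning
  alternate-z : alternate bernoulliSeq ⋆ alternate expm1Seq ≗ -𝟙 ·s zSeq
  alternate-z zero    =
    solve 1 (λ b → (con 𝟙 :* b) :* (con 𝟙 :* con 𝟘) := con -𝟙 :* con 𝟘) refl (bernoulliSeq 0)
  alternate-z (suc k) = trans (alternate-⋆ bernoulliSeq expm1Seq (suc k))
                              (trans (cong (sgn (suc k) ⊗_) (bernoulli⋆expm1 (suc k))) (sgn-z k))
    where
    sgn-z : ∀ k → sgn (suc k) ⊗ zSeq (suc k) ≡ -𝟙 ⊗ zSeq (suc k)
    sgn-z zero    = solve 0 ((con -𝟙 :* con 𝟙) :* con 𝟙 := con -𝟙 :* con 𝟙) refl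
    sgn-z (suc k) = solve 1 (λ s → s :* con 𝟘 := con -𝟙 :* con 𝟘) refl (sgn (suc (suc k)))

expSeq⋆bernoulli : expSeq ⋆ bernoulliSeq ≗ bernoulliSeq +s zSeq
expSeq⋆bernoulli = ⋆-expm1Seq-injective λ n → begin
    ((expSeq ⋆ bernoulliSeq) ⋆ expm1Seq) n
  ≡⟨ expSeq⋆bernoulli⋆expm1 n ⟩
    (zSeq ⋆ expSeq) n
  ≡⟨ trans (⋆-congʳ zSeq expSeq≗δ+expm1 n) (⋆-distribˡ-+s zSeq δ expm1Seq n) ⟩
    (zSeq ⋆ δ) n ⊕ (zSeq ⋆ expm1Seq) n
  ≡⟨ cong (_⊕ (zSeq ⋆ expm1Seq) n) (trans (⋆-comm zSeq δ n) (⋆-identityˡ zSeq n)) ⟩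
    zSeq n ⊕ (zSeq ⋆ expm1Seq) n
  ≡⟨ cong (_⊕ (zSeq ⋆ expm1Seq) n) (bernoulli⋆expm1 n) ⟨
    (bernoulliSeq ⋆ expm1Seq) n ⊕ (zSeq ⋆ expm1Seq) n
  ≡⟨ ⋆-distribʳ-+s expm1Seq bernoulliSeq zSeq n ⟨
    ((bernoulliSeq +s zSeq) ⋆ expm1Seq) n
  ∎
  where
  open ≡-Reasoning
  expSeq≗δ+expm1 : expSeq ≗ δ +s expm1Seq
  expSeq≗δ+expm1 zero    = sym (⊕-identityʳ 𝟙)
  expSeq≗δ+expm1 (suc k) = sym (⊕-identityˡ 𝟙)

bernoulliPoly : Q5 → Seq
bernoulliPoly x = powSeq x ⋆ bernoulliSeq

bernoulliPoly-shift : ∀ x → bernoulliPoly (𝟙 ⊕ x) ≗ bernoulliPoly x +s powSeq x ⋆ zSeq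
bernoulliPoly-shift x n = begin
  (powSeq (𝟙 ⊕ x) ⋆ bernoulliSeq) n              ≡⟨ ⋆-congˡ bernoulliSeq (powSeq⋆expSeq x) n ⟨
  ((powSeq x ⋆ expSeq) ⋆ bernoulliSeq) n          ≡⟨ ⋆-assoc (powSeq x) expSeq bernoulliSeq n ⟩
  (powSeq x ⋆ (expSeq ⋆ bernoulliSeq)) n          ≡⟨ ⋆-congʳ (powSeq x) expSeq⋆bernoulli n ⟩
  (powSeq x ⋆ (bernoulliSeq +s zSeq)) n           ≡⟨ ⋆-distribˡ-+s (powSeq x) bernoulliSeq zSeq n ⟩
  bernoulliPoly x n ⊕ (powSeq x ⋆ zSeq) n         ∎
  where open ≡-Reasoning

bernoulliPoly-reflect : ∀ x → bernoulliPoly (𝟙 ⊕ ⊝ x) ≗ alternate (bernoulliPoly x)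
bernoulliPoly-reflect x n = begin
  (powSeq (𝟙 ⊕ ⊝ x) ⋆ bernoulliSeq) n                 ≡⟨ ⋆-congˡ bernoulliSeq (powSeq⋆expSeq (⊝ x)) n ⟨
  ((powSeq (⊝ x) ⋆ expSeq) ⋆ bernoulliSeq) n           ≡⟨ ⋆-assoc (powSeq (⊝ x)) expSeq bernoulliSeq n ⟩
  (powSeq (⊝ x) ⋆ (expSeq ⋆ bernoulliSeq)) n           ≡⟨ ⋆-cong (⊝-^ℕ x) (sym ∘ alternate-bernoulli) n ⟩
  (alternate (powSeq x) ⋆ alternate bernoulliSeq) n    ≡⟨ alternate-⋆ (powSeq x) bernoulliSeq n ⟩
  sgn n ⊗ bernoulliPoly x n                            ∎
  where open ≡-Reasoning

bernoulliPoly-difference-even : ∀ x n → 2 ∣ n →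
  bernoulliPoly (𝟙 ⊕ x) n ⊖ bernoulliPoly (𝟙 ⊕ ⊝ x) n ≡ (zSeq ⋆ powSeq x) n
bernoulliPoly-difference-even x n 2∣n = begin
    bernoulliPoly (𝟙 ⊕ x) n ⊖ bernoulliPoly (𝟙 ⊕ ⊝ x) n
  ≡⟨ cong₂ _⊖_ (bernoulliPoly-shift x n)
               (trans (bernoulliPoly-reflect x n)
                      (trans (cong (_⊗ bernoulliPoly x n) (sgn-2∣ 2∣n)) (⊗-identityˡ (bernoulliPoly x n)))) ⟩
    (bernoulliPoly x n ⊕ (powSeq x ⋆ zSeq) n) ⊖ bernoulliPoly x n
  ≡⟨ solve 2 (λ p q → (p :+ q) :- p := q) refl (bernoulliPoly x n) ((powSeq x ⋆ zSeq) n) ⟩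
    (powSeq x ⋆ zSeq) n
  ≡⟨ ⋆-comm (powSeq x) zSeq n ⟩
    (zSeq ⋆ powSeq x) n
  ∎
  where open ≡-Reasoning

bernoulliPoly-sum-odd : ∀ x n → ¬ (2 ∣ n) →
  bernoulliPoly (𝟙 ⊕ x) n ⊕ bernoulliPoly (𝟙 ⊕ ⊝ x) n ≡ (zSeq ⋆ powSeq x) n
bernoulliPoly-sum-odd x n 2∤n = begin
    bernoulliPoly (𝟙 ⊕ x) n ⊕ bernoulliPoly (𝟙 ⊕ ⊝ x) n
  ≡⟨ cong₂ _⊕_ (bernoulliPoly-shift x n)
               (trans (bernoulliPoly-reflect x n) (cong (_⊗ bernoulliPoly x n) (sgn-2∤ n 2∤n))) ⟩
    (bernoulliPoly x n ⊕ (powSeq x ⋆ zSeq) n) ⊕ -𝟙 ⊗ bernoulliPoly x n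
  ≡⟨ solve 2 (λ p q → (p :+ q) :+ con -𝟙 :* p := q) refl (bernoulliPoly x n) ((powSeq x ⋆ zSeq) n) ⟩
    (powSeq x ⋆ zSeq) n
  ≡⟨ ⋆-comm (powSeq x) zSeq n ⟩
    (zSeq ⋆ powSeq x) n
  ∎
  where open ≡-Reasoning

-- Fibonacci and Lucas numbers

lucas : ℕ → ℕ
lucas zero          = 2
lucas (suc zero)    = 1
lucas (suc (suc n)) = lucas (suc n) ℕ.+ lucas n

lucas≡suc : ∀ n → ∃ λ p → lucas n ≡ suc p
lucas≡suc zero          = 1 , refl
lucas≡suc (suc zero)    = 0 , refl
lucas≡suc (suc (suc n)) with lucas≡suc (suc n)
... | p , eq = p ℕ.+ lucas n , cong (ℕ._+ lucas n) eq

^ℕ-golden : ∀ x → x ⊗ x ≡ x ⊕ 𝟙 → ∀ n → x ^ℕ suc (suc n) ≡ x ^ℕ suc n ⊕ x ^ℕ n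
^ℕ-golden x x²≡x+1 n = begin
  x ⊗ (x ⊗ x ^ℕ n)            ≡⟨ ⊗-assoc x x (x ^ℕ n) ⟨
  (x ⊗ x) ⊗ x ^ℕ n            ≡⟨ cong (_⊗ x ^ℕ n) x²≡x+1 ⟩
  (x ⊕ 𝟙) ⊗ x ^ℕ n            ≡⟨ solve 2 (λ x p → (x :+ con 𝟙) :* p := x :* p :+ p) refl x (x ^ℕ n) ⟩
  x ⊗ x ^ℕ n ⊕ x ^ℕ n         ∎
  where open ≡-Reasoning

L-+ : ∀ n → L (+ n) ≡ fromℕ (lucas n)
L-+ zero          = refl
L-+ (suc zero)    = refl
L-+ (suc (suc n)) = begin
    α ^ℕ suc (suc n) ⊕ β ^ℕ suc (suc n)
  ≡⟨ cong₂ _⊕_ (^ℕ-golden α refl n) (^ℕ-golden β refl n) ⟩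
    (α ^ℕ suc n ⊕ α ^ℕ n) ⊕ (β ^ℕ suc n ⊕ β ^ℕ n)
  ≡⟨ interchange (α ^ℕ suc n) (α ^ℕ n) (β ^ℕ suc n) (β ^ℕ n) ⟩
    L (+ suc n) ⊕ L (+ n)
  ≡⟨ cong₂ _⊕_ (L-+ (suc n)) (L-+ n) ⟩
    fromℕ (lucas (suc n)) ⊕ fromℕ (lucas n)
  ≡⟨ fromℕ-+ (lucas (suc n)) (lucas n) ⟨
    fromℕ (lucas (suc (suc n)))
  ∎
  where open ≡-Reasoning

-- α⁻¹ = −β and β⁻¹ = −α
L-negative : ∀ m → L -[1+ m ] ≡ sgn (suc m) ⊗ L (+ suc m)
L-negative m = begin
    inv (α ^ℕ suc m) ⊕ inv (β ^ℕ suc m)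
  ≡⟨ cong₂ _⊕_ (inv-unique (α ^ℕ suc m) ((⊝ β) ^ℕ suc m) (^ℕ-inverse α (⊝ β) refl (suc m)))
               (inv-unique (β ^ℕ suc m) ((⊝ α) ^ℕ suc m) (^ℕ-inverse β (⊝ α) refl (suc m))) ⟩
    (⊝ β) ^ℕ suc m ⊕ (⊝ α) ^ℕ suc m
  ≡⟨ cong₂ _⊕_ (⊝-^ℕ β (suc m)) (⊝-^ℕ α (suc m)) ⟩
    sgn (suc m) ⊗ β ^ℕ suc m ⊕ sgn (suc m) ⊗ α ^ℕ suc m
  ≡⟨ solve 3 (λ s b a → s :* b :+ s :* a := s :* (a :+ b)) refl (sgn (suc m)) (β ^ℕ suc m) (α ^ℕ suc m) ⟩
    sgn (suc m) ⊗ L (+ suc m)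
  ∎
  where open ≡-Reasoning

L-invertible : ∀ j → Invertible (L j)
L-invertible (+ m) with lucas≡suc m
... | p , lucas≡1+p = subst Invertible (sym (trans (L-+ m) (cong fromℕ lucas≡1+p))) (fromℕ-suc-invertible p)
L-invertible -[1+ m ] =
  subst Invertible (sym (L-negative m))
    (⊗-invertible (sgn (suc m)) (L (+ suc m)) (sgn (suc m) , sgn-square (suc m)) (L-invertible (+ suc m)))

two : Q5
two = fromℕ 2

fromℕ-2^ : ∀ k → fromℕ (2 ℕ.^ k) ≡ two ^ℕ k
fromℕ-2^ zero    = refl
fromℕ-2^ (suc k) = trans (fromℕ-* 2 (2 ℕ.^ k)) (cong (two ⊗_) (fromℕ-2^ k))

module _ (j : ℤ) where

  L⁻¹ : Q5
  L⁻¹ = proj₁ (L-invertible j)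

  L⊗L⁻¹ : L j ⊗ L⁻¹ ≡ 𝟙
  L⊗L⁻¹ = proj₂ (L-invertible j)

  2α/L 2β/L √5F/L : Q5
  2α/L  = two ⊗ α ^ℤ j ⊗ L⁻¹
  2β/L  = two ⊗ β ^ℤ j ⊗ L⁻¹
  √5F/L = (√5 ⊗ F j) ⊘ L j

  √5F/L≡ : √5F/L ≡ (α ^ℤ j ⊖ β ^ℤ j) ⊗ L⁻¹
  √5F/L≡ = begin
      √5 ⊗ ((α ^ℤ j ⊖ β ^ℤ j) ⊗ inv √5) ⊗ inv (L j)
    ≡⟨ cong (√5 ⊗ ((α ^ℤ j ⊖ β ^ℤ j) ⊗ inv √5) ⊗_) (inv-unique (L j) L⁻¹ L⊗L⁻¹) ⟩
      √5 ⊗ ((α ^ℤ j ⊖ β ^ℤ j) ⊗ inv √5) ⊗ L⁻¹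
    ≡⟨ solve 4 (λ r d s l → r :* (d :* s) :* l := (d :* l) :* (r :* s))
             refl √5 (α ^ℤ j ⊖ β ^ℤ j) (inv √5) L⁻¹ ⟩
      (α ^ℤ j ⊖ β ^ℤ j) ⊗ L⁻¹ ⊗ (√5 ⊗ inv √5)
    ≡⟨ ⊗-identityʳ ((α ^ℤ j ⊖ β ^ℤ j) ⊗ L⁻¹) ⟩ -- √5 ⊗ inv √5 computes to 𝟙
      (α ^ℤ j ⊖ β ^ℤ j) ⊗ L⁻¹
    ∎
    where open ≡-Reasoning

  2α/L≡𝟙⊕√5F/L : 2α/L ≡ 𝟙 ⊕ √5F/L
  2α/L≡𝟙⊕√5F/L = trans
    (solve 3 (λ a b l → (con 𝟙 :+ con 𝟙) :* a :* l := (a :+ b) :* l :+ (a :- b) :* l)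
           refl (α ^ℤ j) (β ^ℤ j) L⁻¹)
    (cong₂ _⊕_ L⊗L⁻¹ (sym √5F/L≡))

  2β/L≡𝟙⊖√5F/L : 2β/L ≡ 𝟙 ⊕ ⊝ √5F/L
  2β/L≡𝟙⊖√5F/L = trans
    (solve 3 (λ a b l → (con 𝟙 :+ con 𝟙) :* b :* l := (a :+ b) :* l :+ :- ((a :- b) :* l))
           refl (α ^ℤ j) (β ^ℤ j) L⁻¹)
    (cong₂ _⊕_ L⊗L⁻¹ (cong ⊝_ (sym √5F/L≡)))

  scaled-power : ∀ x y → x ⊗ y ≡ 𝟙 → ∀ k →
    fromℕ (2 ℕ.^ k) ⊗ x ^ℤ (j ℤ.* + k) ⊗ inv (L j ^ℕ k) ≡ (two ⊗ x ^ℤ j ⊗ L⁻¹) ^ℕ k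
  scaled-power x y xy≡1 k = begin
      fromℕ (2 ℕ.^ k) ⊗ x ^ℤ (j ℤ.* + k) ⊗ inv (L j ^ℕ k)
    ≡⟨ cong₂ (λ t p → t ⊗ p ⊗ inv (L j ^ℕ k)) (fromℕ-2^ k) (sym (^ℤ-*-assoc x y xy≡1 j k)) ⟩
      two ^ℕ k ⊗ (x ^ℤ j) ^ℕ k ⊗ inv (L j ^ℕ k)
    ≡⟨ cong (two ^ℕ k ⊗ (x ^ℤ j) ^ℕ k ⊗_)
            (inv-unique (L j ^ℕ k) (L⁻¹ ^ℕ k) (^ℕ-inverse (L j) L⁻¹ L⊗L⁻¹ k)) ⟩
      two ^ℕ k ⊗ (x ^ℤ j) ^ℕ k ⊗ L⁻¹ ^ℕ k
    ≡⟨ trans (^ℕ-distribʳ-⊗ (two ⊗ x ^ℤ j) L⁻¹ k)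
             (cong (_⊗ L⁻¹ ^ℕ k) (^ℕ-distribʳ-⊗ two (x ^ℤ j) k)) ⟨
      (two ⊗ x ^ℤ j ⊗ L⁻¹) ^ℕ k
    ∎
    where open ≡-Reasoning

  scaledF scaledL : Seq
  scaledF k = (fromℕ (2 ℕ.^ k) ⊗ F (j ℤ.* + k)) ⊘ (L j ^ℕ k)
  scaledL k = (fromℕ (2 ℕ.^ k) ⊗ L (j ℤ.* + k)) ⊘ (L j ^ℕ k)

  scaledF≗ : scaledF ≗ inv √5 ·s (powSeq 2α/L +s -𝟙 ·s powSeq 2β/L)
  scaledF≗ k = begin
      (c ⊗ ((α ^ℤ (j ℤ.* + k) ⊖ β ^ℤ (j ℤ.* + k)) ⊗ inv √5)) ⊗ l
    ≡⟨ solve 5 (λ c a b s l → (c :* ((a :- b) :* s)) :* l := s :* (c :* a :* l :+ con -𝟙 :* (c :* b :* l)))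
             refl c (α ^ℤ (j ℤ.* + k)) (β ^ℤ (j ℤ.* + k)) (inv √5) l ⟩
      inv √5 ⊗ (c ⊗ α ^ℤ (j ℤ.* + k) ⊗ l ⊕ -𝟙 ⊗ (c ⊗ β ^ℤ (j ℤ.* + k) ⊗ l))
    ≡⟨ cong₂ (λ p q → inv √5 ⊗ (p ⊕ -𝟙 ⊗ q))
             (scaled-power α (⊝ β) refl k) (scaled-power β (⊝ α) refl k) ⟩
      inv √5 ⊗ (2α/L ^ℕ k ⊕ -𝟙 ⊗ 2β/L ^ℕ k)
    ∎
    where
    open ≡-Reasoning
    c l : Q5
    c = fromℕ (2 ℕ.^ k)
    l = inv (L j ^ℕ k)

  scaledL≗ : scaledL ≗ powSeq 2α/L +s powSeq 2β/L
  scaledL≗ k = begin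
      (c ⊗ (α ^ℤ (j ℤ.* + k) ⊕ β ^ℤ (j ℤ.* + k))) ⊗ l
    ≡⟨ solve 4 (λ c a b l → (c :* (a :+ b)) :* l := c :* a :* l :+ c :* b :* l)
             refl c (α ^ℤ (j ℤ.* + k)) (β ^ℤ (j ℤ.* + k)) l ⟩
      c ⊗ α ^ℤ (j ℤ.* + k) ⊗ l ⊕ c ⊗ β ^ℤ (j ℤ.* + k) ⊗ l
    ≡⟨ cong₂ _⊕_ (scaled-power α (⊝ β) refl k) (scaled-power β (⊝ α) refl k) ⟩
      2α/L ^ℕ k ⊕ 2β/L ^ℕ k
    ∎
    where
    open ≡-Reasoning
    c l : Q5
    c = fromℕ (2 ℕ.^ k)
    l = inv (L j ^ℕ k)

  lhsF≡ : ∀ n → lhsF j n ≡ inv √5 ⊗ (bernoulliPoly 2α/L n ⊖ bernoulliPoly 2β/L n)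
  lhsF≡ n = begin
      lhsF j n
    ≡⟨ ⋆≡Σ n scaledF bernoulliSeq ⟨
      (scaledF ⋆ bernoulliSeq) n
    ≡⟨ trans (⋆-congˡ bernoulliSeq scaledF≗ n)
             (⋆-scaleˡ (inv √5) (powSeq 2α/L +s -𝟙 ·s powSeq 2β/L) bernoulliSeq n) ⟩
      inv √5 ⊗ ((powSeq 2α/L +s -𝟙 ·s powSeq 2β/L) ⋆ bernoulliSeq) n
    ≡⟨ cong (inv √5 ⊗_) (trans (⋆-distribʳ-+s bernoulliSeq (powSeq 2α/L) (-𝟙 ·s powSeq 2β/L) n)
                               (cong (bernoulliPoly 2α/L n ⊕_) (⋆-scaleˡ -𝟙 (powSeq 2β/L) bernoulliSeq n))) ⟩
      inv √5 ⊗ (bernoulliPoly 2α/L n ⊕ -𝟙 ⊗ bernoulliPoly 2β/L n)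
    ≡⟨ cong (inv √5 ⊗_) (solve 2 (λ p q → p :+ con -𝟙 :* q := p :- q)
                                 refl (bernoulliPoly 2α/L n) (bernoulliPoly 2β/L n)) ⟩
      inv √5 ⊗ (bernoulliPoly 2α/L n ⊖ bernoulliPoly 2β/L n)
    ∎
    where open ≡-Reasoning

  lhsL≡ : ∀ n → lhsL j n ≡ bernoulliPoly 2α/L n ⊕ bernoulliPoly 2β/L n
  lhsL≡ n = begin
      lhsL j n
    ≡⟨ ⋆≡Σ n scaledL bernoulliSeq ⟨
      (scaledL ⋆ bernoulliSeq) n
    ≡⟨ ⋆-congˡ bernoulliSeq scaledL≗ n ⟩
      ((powSeq 2α/L +s powSeq 2β/L) ⋆ bernoulliSeq) n
    ≡⟨ ⋆-distribʳ-+s bernoulliSeq (powSeq 2α/L) (powSeq 2β/L) n ⟩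
      bernoulliPoly 2α/L n ⊕ bernoulliPoly 2β/L n
    ∎
    where open ≡-Reasoning

  rhsEven≡ : ∀ n → rhsEven j n ≡ inv √5 ⊗ (zSeq ⋆ powSeq √5F/L) n
  rhsEven≡ zero    = sym (solve 1 (λ s → s :* (con 𝟘 :* con 𝟙) := con 𝟘) refl (inv √5))
  rhsEven≡ (suc m) = trans
    (solve 3 (λ c s p → (c :* s) :* p := s :* (c :* p)) refl (fromℕ (suc m)) (inv √5) (√5F/L ^ℕ m))
    (cong (inv √5 ⊗_) (sym (zSeq⋆-suc (powSeq √5F/L) m)))

  rhsOdd≡ : ∀ n → rhsOdd j n ≡ (zSeq ⋆ powSeq √5F/L) n
  rhsOdd≡ zero    = sym (zSeq⋆-zero (powSeq √5F/L))
  rhsOdd≡ (suc m) = sym (zSeq⋆-suc (powSeq √5F/L) m)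

theorem16 : (j : ℤ) (n : ℕ) →
    (2 ∣ n → lhsF j n ≡ rhsEven j n) × (¬ (2 ∣ n) → lhsL j n ≡ rhsOdd j n)
theorem16 j n = even , odd
  where
  open ≡-Reasoning
  even : 2 ∣ n → lhsF j n ≡ rhsEven j n
  even 2∣n = begin
      lhsF j n
    ≡⟨ lhsF≡ j n ⟩
      inv √5 ⊗ (bernoulliPoly (2α/L j) n ⊖ bernoulliPoly (2β/L j) n)
    ≡⟨ cong₂ (λ a b → inv √5 ⊗ (bernoulliPoly a n ⊖ bernoulliPoly b n))
             (2α/L≡𝟙⊕√5F/L j) (2β/L≡𝟙⊖√5F/L j) ⟩
      inv √5 ⊗ (bernoulliPoly (𝟙 ⊕ √5F/L j) n ⊖ bernoulliPoly (𝟙 ⊕ ⊝ √5F/L j) n)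
    ≡⟨ cong (inv √5 ⊗_) (bernoulliPoly-difference-even (√5F/L j) n 2∣n) ⟩
      inv √5 ⊗ (zSeq ⋆ powSeq (√5F/L j)) n
    ≡⟨ rhsEven≡ j n ⟨
      rhsEven j n
    ∎
  odd : ¬ (2 ∣ n) → lhsL j n ≡ rhsOdd j n
  odd 2∤n = begin
      lhsL j n
    ≡⟨ lhsL≡ j n ⟩
      bernoulliPoly (2α/L j) n ⊕ bernoulliPoly (2β/L j) n
    ≡⟨ cong₂ (λ a b → bernoulliPoly a n ⊕ bernoulliPoly b n)
             (2α/L≡𝟙⊕√5F/L j) (2β/L≡𝟙⊖√5F/L j) ⟩
      bernoulliPoly (𝟙 ⊕ √5F/L j) n ⊕ bernoulliPoly (𝟙 ⊕ ⊝ √5F/L j) n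
    ≡⟨ bernoulliPoly-sum-odd (√5F/L j) n 2∤n ⟩
      (zSeq ⋆ powSeq (√5F/L j)) n
    ≡⟨ rhsOdd≡ j n ⟨
      rhsOdd j n
    ∎
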